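{- Let $n\ge 1$ and let $O=[0,1]^n\subset\mathbb{R}^n$ (the order polytope of the $n$-element antichain $P_n$). Let $V=\mathrm{span}\{e_1+\dots+e_n\}$ and let $\pi:\mathbb{R}^n\to\mathbb{R}^{n-1}$ be the linear map $\pi(v)=\sum_{i=1}^{n-1}(v_i-v_n)e_i$, which identifies $\mathbb{R}^n/V$ with $\mathbb{R}^{n-1}$ and $\mathbb{Z}^n/(\mathbb{Z}^n\cap V)$ with $\mathbb{Z}^{n-1}$. Then the quotient polytope $O^{\mathrm{eq}}_{P_n}=\pi(O)\subset\mathbb{R}^{n-1}$ is unimodularly equivalent to $A_{n-1}^\vee$.
   Context: For $d\ge 1$, $A_d=\mathrm{conv}(\{\pm(e_i+e_{i+1}+\dots+e_j):1\le i\le j\le d\})\subset\mathbb{R}^d$ is the root polytope of type A, where $e_i$ are the standard unit vectors. For a polytope $Q\subset\mathbb{R}^d$, its polar dual is $Q^\vee=\{x\in\mathbb{R}^d:\langle x,y\rangle\ge -1 \text{ for all } y\in Q\}$. Two integral polytopes are unimodularly equivalent if one is mapped to the other by an affine map $x\mapsto Ux+b$ with $U\in GL_d(\mathbb{Z})$, $b\in\mathbb{Z}^d$.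
   Formalization: The cube $O$, the quotient polytope $O^{\mathrm{eq}}_{P_n}$ and $A_{n-1}^\vee$ consist only of their points with rational coordinates, lying in ℚ^n and ℚ^(n-1) rather than ℝ^n and ℝ^(n-1). -}

module Defs where

open import Data.Nat using (ℕ; zero; suc)
open import Data.Integer using (ℤ)
open import Data.Rational using (ℚ; 0ℚ; 1ℚ; _+_; _*_; -_; _-_; _≤_; _/_)
open import Data.Fin using (Fin; zero; suc; inject₁; fromℕ) renaming (_≤_ to _≤ᶠ_)
open import Data.Fin.Properties using () renaming (_≤?_ to _≤ᶠ?_)
open import Data.List using (List; []; _∷_)
open import Data.Product using (Σ; ∃; ∃-syntax; _×_; _,_)
open import Data.Sum using (_⊎_)
open import Relation.Nullary using (yes; no)
open import Relation.Binary.PropositionalEquality using (_≡_)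
open import Function.Bundles using (_⇔_)

Point : ℕ → Set
Point d = Fin d → ℚ

PSet : ℕ → Set₁
PSet d = Point d → Set

_≈ₚ_ : ∀ {d} → Point d → Point d → Set
x ≈ₚ y = ∀ i → x i ≡ y i

Σᶠ : ∀ {d} → (Fin d → ℚ) → ℚ
Σᶠ {zero}  f = 0ℚ
Σᶠ {suc d} f = f zero + Σᶠ (λ i → f (suc i))

⟨_,_⟩ : ∀ {d} → Point d → Point d → ℚ
⟨ x , y ⟩ = Σᶠ (λ i → x i * y i)

0ₚ : ∀ {d} → Point d
0ₚ _ = 0ℚ

_+ₚ_ : ∀ {d} → Point d → Point d → Point d
(x +ₚ y) i = x i + y i

_·ₚ_ : ∀ {d} → ℚ → Point d → Point d
(c ·ₚ x) i = c * x i

-ₚ_ : ∀ {d} → Point d → Point d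
(-ₚ x) i = - (x i)

-- A formal convex combination: list of (weight, point) pairs
weights : ∀ {d} → List (ℚ × Point d) → ℚ
weights []            = 0ℚ
weights ((c , _) ∷ l) = c + weights l

combo : ∀ {d} → List (ℚ × Point d) → Point d
combo []            = 0ₚ
combo ((c , p) ∷ l) = (c ·ₚ p) +ₚ combo l

Admissible : ∀ {d} → PSet d → List (ℚ × Point d) → Set
Admissible S []            = Data.Unit.⊤ where import Data.Unit
Admissible S ((c , p) ∷ l) = (0ℚ ≤ c) × S p × Admissible S l

conv : ∀ {d} → PSet d → PSet d
conv S x = Σ (List (ℚ × Point _)) λ l →
  Admissible S l × (weights l ≡ 1ℚ) × (x ≈ₚ combo l)

polar : ∀ {d} → PSet d → PSet d
polar Q x = ∀ y → Q y → - 1ℚ ≤ ⟨ x , y ⟩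

interval : ∀ {d} → Fin d → Fin d → Point d
interval i j k with i ≤ᶠ? k | k ≤ᶠ? j
... | yes _ | yes _ = 1ℚ
... | _     | _     = 0ℚ

rootGens : (d : ℕ) → PSet d
rootGens d p = ∃[ i ] ∃[ j ] (i ≤ᶠ j × (p ≈ₚ interval i j ⊎ p ≈ₚ (-ₚ interval i j)))

A : (d : ℕ) → PSet d
A d = conv (rootGens d)

cube : (n : ℕ) → PSet n
cube n x = ∀ i → (0ℚ ≤ x i) × (x i ≤ 1ℚ)

proj : ∀ {m} → Point (suc m) → Point m
proj {m} v i = v (inject₁ i) - v (fromℕ m)

image : ∀ {a b} → (Point a → Point b) → PSet a → PSet b
image f S y = ∃[ x ] (S x × (f x ≈ₚ y))

Matℤ : ℕ → Set
Matℤ d = Fin d → Fin d → ℤ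

_∙ℤ_ : ∀ {d} → Matℤ d → Matℤ d → Matℤ d
(U ∙ℤ V) i j = Σℤ (λ k → U i k Data.Integer.* V k j)
  where
  import Data.Integer
  Σℤ : ∀ {e} → (Fin e → ℤ) → ℤ
  Σℤ {zero} f = Data.Integer.+ 0
  Σℤ {suc e} f = f zero Data.Integer.+ Σℤ (λ i → f (suc i))

Idℤ : ∀ {d} → Matℤ d
Idℤ i j with i Data.Fin.≟ j where import Data.Fin
... | yes _ = Data.Integer.+ 1 where import Data.Integer
... | no _  = Data.Integer.+ 0 where import Data.Integer

GLℤ : ∀ {d} → Matℤ d → Set
GLℤ {d} U = Σ (Matℤ d) λ V → (∀ i j → (U ∙ℤ V) i j ≡ Idℤ i j) × (∀ i j → (V ∙ℤ U) i j ≡ Idℤ i j)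

ℤ→ℚ : ℤ → ℚ
ℤ→ℚ z = z / 1

affine : ∀ {d} → Matℤ d → (Fin d → ℤ) → Point d → Point d
affine U b x i = Σᶠ (λ k → ℤ→ℚ (U i k) * x k) + ℤ→ℚ (b i)

UnimodEquiv : ∀ {d} → PSet d → PSet d → Set
UnimodEquiv {d} P Q = Σ (Matℤ d) λ U → Σ (Fin d → ℤ) λ b →
  GLℤ U × (∀ y → Q y ⇔ image (affine U b) P y)

-- The difference operator (Δx)₀ = x₀, (Δx)ₖ = xₖ − xₖ₋₁ is unimodular, its inverse being
-- the prefix-sum operator s.  Pairing y with eᵢ + … + eⱼ gives s(y)ⱼ − s(y)ᵢ₋₁, so y lies in
-- A_{n−1}^∨ iff all prefix sums of y and all their pairwise differences lie in [−1, 1].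
-- That is exactly the description of π([0,1]ⁿ): π(z) has entries zᵢ − zₙ and differences
-- zᵢ − zⱼ, and conversely such an x lifts to z = (x + t, t) with t = max(0, −min x).
module Submission where

open import Defs
open import Data.Nat as ℕ using (ℕ; zero; suc; z≤n; s≤s)
import Data.Nat.Properties as ℕP
open import Data.Integer as ℤ using (ℤ; 0ℤ; 1ℤ; -1ℤ)
import Data.Integer.Properties as ℤP
open import Data.Rational using (ℚ; 0ℚ; 1ℚ; _+_; _*_; -_; _-_; _≤_; _⊓_; *≤*; nonNegative)
open import Data.Rational.Properties
  using ( +-identityˡ; +-identityʳ; +-inverseʳ; *-identityˡ; *-identityʳ; *-zeroˡ; *-zeroʳ
        ; *-distribˡ-+; +-*-commutativeRing; ≤-refl; ≤-reflexive; ≤-trans; module ≤-Reasoning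
        ; +-mono-≤; +-monoˡ-≤; *-monoˡ-≤-nonNeg; neg-antimono-≤; p⊓q≤p; p≤q⇒r⊓p≤q; ⊓-sel )
open import Data.Rational.Solver using (module +-*-Solver)
open import Data.Fin using (Fin; zero; suc; inject₁; lower₁; fromℕ; toℕ) renaming (_≤_ to _≤ᶠ_; _<_ to _<ᶠ_)
import Data.Fin.Properties as FP
open import Data.Fin.Induction using (<-weakInduction)
open import Data.List using ([]; _∷_)
open import Data.Product using (∃; _×_; _,_; proj₁; proj₂)
open import Data.Sum using (_⊎_; inj₁; inj₂)
open import Data.Unit using (tt)
open import Data.Empty using (⊥-elim)
open import Function.Bundles using (_⇔_; mk⇔; Equivalence)
import Function.Properties.Equivalence as ⇔
open import Relation.Nullary using (¬_; Dec; yes; no)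
open import Relation.Binary.Definitions using (tri<; tri≈; tri>)
open import Relation.Binary.PropositionalEquality
open import Algebra.Bundles using (CommutativeRing)
import Algebra.Properties.Semiring.Sum as SemiringSum

open +-*-Solver

private
  module ℚΣ = SemiringSum (CommutativeRing.semiring +-*-commutativeRing)
  module ℤΣ = SemiringSum ℤP.+-*-semiring

  variable
    d e n : ℕ

-- Inner products

Σᶠ≡sum : (f : Fin d → ℚ) → Σᶠ f ≡ ℚΣ.sum f
Σᶠ≡sum {zero}  f = refl
Σᶠ≡sum {suc d} f = cong (f zero +_) (Σᶠ≡sum (λ i → f (suc i)))

Σᶠ-zero : (f : Fin d → ℚ) → (∀ k → f k ≡ 0ℚ) → Σᶠ f ≡ 0ℚ
Σᶠ-zero {d} f f≡0 = begin
  Σᶠ f                   ≡⟨ Σᶠ≡sum f ⟩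
  ℚΣ.sum f               ≡⟨ ℚΣ.sum-cong-≗ f≡0 ⟩
  ℚΣ.sum {d} (λ _ → 0ℚ)  ≡⟨ ℚΣ.sum-replicate-zero d ⟩
  0ℚ                     ∎
  where open ≡-Reasoning

Σᶠ-single : (f : Fin d → ℚ) (a : Fin d) → (∀ k → k ≢ a → f k ≡ 0ℚ) → Σᶠ f ≡ f a
Σᶠ-single {suc d} f zero    f≡0 = begin
  f zero + Σᶠ (λ k → f (suc k))  ≡⟨ cong (f zero +_) (Σᶠ-zero (λ k → f (suc k)) (λ k → f≡0 (suc k) (λ ()))) ⟩
  f zero + 0ℚ                    ≡⟨ +-identityʳ (f zero) ⟩
  f zero                         ∎
  where open ≡-Reasoning
Σᶠ-single {suc d} f (suc a) f≡0 = begin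
  f zero + Σᶠ (λ k → f (suc k))  ≡⟨ cong₂ _+_ (f≡0 zero (λ ())) (Σᶠ-single (λ k → f (suc k)) a f∘suc≡0) ⟩
  0ℚ + f (suc a)                 ≡⟨ +-identityˡ (f (suc a)) ⟩
  f (suc a)                      ∎
  where
  open ≡-Reasoning
  f∘suc≡0 : ∀ k → k ≢ a → f (suc k) ≡ 0ℚ
  f∘suc≡0 k k≢a = f≡0 (suc k) (λ sk≡sa → k≢a (FP.suc-injective sk≡sa))

⟨⟩-congʳ : (y : Point d) {p q : Point d} → p ≈ₚ q → ⟨ y , p ⟩ ≡ ⟨ y , q ⟩
⟨⟩-congʳ y {p} {q} p≈q = begin
  ⟨ y , p ⟩                 ≡⟨ Σᶠ≡sum (λ k → y k * p k) ⟩
  ℚΣ.sum (λ k → y k * p k)  ≡⟨ ℚΣ.sum-cong-≗ (λ k → cong (y k *_) (p≈q k)) ⟩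
  ℚΣ.sum (λ k → y k * q k)  ≡⟨ Σᶠ≡sum (λ k → y k * q k) ⟨
  ⟨ y , q ⟩                 ∎
  where open ≡-Reasoning

⟨⟩-zeroʳ : (y : Point d) → ⟨ y , 0ₚ ⟩ ≡ 0ℚ
⟨⟩-zeroʳ y = Σᶠ-zero (λ k → y k * 0ℚ) (λ k → *-zeroʳ (y k))

⟨⟩-distribʳ-+ : (y p q : Point d) → ⟨ y , p +ₚ q ⟩ ≡ ⟨ y , p ⟩ + ⟨ y , q ⟩
⟨⟩-distribʳ-+ y p q = begin
  ⟨ y , p +ₚ q ⟩
    ≡⟨ Σᶠ≡sum (λ k → y k * (p k + q k)) ⟩
  ℚΣ.sum (λ k → y k * (p k + q k))
    ≡⟨ ℚΣ.sum-cong-≗ (λ k → *-distribˡ-+ (y k) (p k) (q k)) ⟩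
  ℚΣ.sum (λ k → y k * p k + y k * q k)
    ≡⟨ ℚΣ.∑-distrib-+ (λ k → y k * p k) (λ k → y k * q k) ⟩
  ℚΣ.sum (λ k → y k * p k) + ℚΣ.sum (λ k → y k * q k)
    ≡⟨ cong₂ _+_ (Σᶠ≡sum (λ k → y k * p k)) (Σᶠ≡sum (λ k → y k * q k)) ⟨
  ⟨ y , p ⟩ + ⟨ y , q ⟩
    ∎
  where open ≡-Reasoning

⟨⟩-scaleʳ : (y p : Point d) (c : ℚ) → ⟨ y , c ·ₚ p ⟩ ≡ c * ⟨ y , p ⟩
⟨⟩-scaleʳ y p c = begin
  ⟨ y , c ·ₚ p ⟩
    ≡⟨ Σᶠ≡sum (λ k → y k * (c * p k)) ⟩
  ℚΣ.sum (λ k → y k * (c * p k))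
    ≡⟨ ℚΣ.sum-cong-≗ (λ k → solve 3 (λ a b c → a :* (c :* b) := c :* (a :* b)) refl (y k) (p k) c) ⟩
  ℚΣ.sum (λ k → c * (y k * p k))
    ≡⟨ ℚΣ.*-distribˡ-sum c (λ k → y k * p k) ⟨
  c * ℚΣ.sum (λ k → y k * p k)
    ≡⟨ cong (c *_) (Σᶠ≡sum (λ k → y k * p k)) ⟨
  c * ⟨ y , p ⟩
    ∎
  where open ≡-Reasoning

⟨⟩-negʳ : (y p : Point d) → ⟨ y , -ₚ p ⟩ ≡ - ⟨ y , p ⟩
⟨⟩-negʳ y p = begin
  ⟨ y , -ₚ p ⟩         ≡⟨ ⟨⟩-congʳ y (λ k → solve 1 (λ a → :- a := :- con 1ℚ :* a) refl (p k)) ⟩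
  ⟨ y , (- 1ℚ) ·ₚ p ⟩  ≡⟨ ⟨⟩-scaleʳ y p (- 1ℚ) ⟩
  - 1ℚ * ⟨ y , p ⟩     ≡⟨ solve 1 (λ a → :- con 1ℚ :* a := :- a) refl ⟨ y , p ⟩ ⟩
  - ⟨ y , p ⟩          ∎
  where open ≡-Reasoning

-- The polar of the root polytope

0≤1 : 0ℚ ≤ 1ℚ
0≤1 = *≤* (ℤ.+≤+ z≤n)

⊆-conv : {S : PSet d} {p : Point d} → S p → conv S p
⊆-conv {p = p} p∈S =
  ((1ℚ , p) ∷ []) , (0≤1 , p∈S , tt) , refl , (λ k → sym (trans (+-identityʳ _) (*-identityˡ (p k))))

polar-conv : {S : PSet d} (y : Point d) → (∀ g → S g → - 1ℚ ≤ ⟨ y , g ⟩) → polar (conv S) y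
polar-conv {S = S} y bound p (l , l-adm , l-weights , p≈l) = begin
  - 1ℚ             ≡⟨ cong -_ l-weights ⟨
  - weights l      ≤⟨ combo-bound l l-adm ⟩
  ⟨ y , combo l ⟩  ≡⟨ ⟨⟩-congʳ y p≈l ⟨
  ⟨ y , p ⟩        ∎
  where
  open ≤-Reasoning
  combo-bound : ∀ l → Admissible S l → - weights l ≤ ⟨ y , combo l ⟩
  combo-bound []            _                     = ≤-reflexive (sym (⟨⟩-zeroʳ y))
  combo-bound ((c , g) ∷ l) (0≤c , g∈S , l-adm) = begin
    - (c + weights l)
      ≡⟨ solve 2 (λ c w → :- (c :+ w) := c :* (:- con 1ℚ) :+ (:- w)) refl c (weights l) ⟩
    c * - 1ℚ + - weights l
      ≤⟨ +-mono-≤ (*-monoˡ-≤-nonNeg c {{nonNegative 0≤c}} (bound g g∈S)) (combo-bound l l-adm) ⟩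
    c * ⟨ y , g ⟩ + ⟨ y , combo l ⟩
      ≡⟨ cong (_+ ⟨ y , combo l ⟩) (⟨⟩-scaleʳ y g c) ⟨
    ⟨ y , c ·ₚ g ⟩ + ⟨ y , combo l ⟩
      ≡⟨ ⟨⟩-distribʳ-+ y (c ·ₚ g) (combo l) ⟨
    ⟨ y , (c ·ₚ g) +ₚ combo l ⟩
      ∎

interval-inside : (i j k : Fin d) → i ≤ᶠ k → k ≤ᶠ j → interval i j k ≡ 1ℚ
interval-inside i j k i≤k k≤j with i FP.≤? k | k FP.≤? j
... | yes _  | yes _  = refl
... | no i≰k | _      = ⊥-elim (i≰k i≤k)
... | yes _  | no k≰j = ⊥-elim (k≰j k≤j)

interval-outsideˡ : (i j k : Fin d) → ¬ i ≤ᶠ k → interval i j k ≡ 0ℚ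
interval-outsideˡ i j k i≰k with i FP.≤? k | k FP.≤? j
... | yes i≤k | _ = ⊥-elim (i≰k i≤k)
... | no _    | _ = refl

interval-outsideʳ : (i j k : Fin d) → ¬ k ≤ᶠ j → interval i j k ≡ 0ℚ
interval-outsideʳ i j k k≰j with i FP.≤? k | k FP.≤? j
... | _     | yes k≤j = ⊥-elim (k≰j k≤j)
... | yes _ | no _    = refl
... | no _  | no _    = refl

⟨⟩-interval-diag : (y : Point d) (k : Fin d) → ⟨ y , interval k k ⟩ ≡ y k
⟨⟩-interval-diag y k = begin
  ⟨ y , interval k k ⟩  ≡⟨ Σᶠ-single (λ l → y l * interval k k l) k off-diagonal ⟩
  y k * interval k k k  ≡⟨ cong (y k *_) (interval-inside k k k ℕP.≤-refl ℕP.≤-refl) ⟩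
  y k * 1ℚ              ≡⟨ *-identityʳ (y k) ⟩
  y k                   ∎
  where
  open ≡-Reasoning
  vanishes : ∀ {l} → interval k k l ≡ 0ℚ → y l * interval k k l ≡ 0ℚ
  vanishes {l} I≡0 = trans (cong (y l *_) I≡0) (*-zeroʳ (y l))
  off-diagonal : ∀ l → l ≢ k → y l * interval k k l ≡ 0ℚ
  off-diagonal l l≢k with FP.≤-total k l
  ... | inj₁ k≤l = vanishes (interval-outsideʳ k k l (λ l≤k → l≢k (FP.≤-antisym l≤k k≤l)))
  ... | inj₂ l≤k = vanishes (interval-outsideˡ k k l (λ k≤l → l≢k (FP.≤-antisym l≤k k≤l)))

inject₁-≤ : {k : Fin (suc n)} (i : Fin n) → toℕ k ℕ.≤ toℕ i → k ≤ᶠ inject₁ i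
inject₁-≤ {k = k} i = subst (toℕ k ℕ.≤_) (sym (FP.toℕ-inject₁ i))

inject₁-≤⁻¹ : {k : Fin (suc n)} (i : Fin n) → k ≤ᶠ inject₁ i → toℕ k ℕ.≤ toℕ i
inject₁-≤⁻¹ {k = k} i = subst (toℕ k ℕ.≤_) (FP.toℕ-inject₁ i)

interval-split : (i : Fin n) (j : Fin (suc n)) → suc i ≤ᶠ j →
  interval zero j ≈ₚ (interval zero (inject₁ i) +ₚ interval (suc i) j)
interval-split i j i<j k = split (toℕ k ℕP.≤? toℕ i) (k FP.≤? j)
  where
  open ≡-Reasoning
  split : Dec (toℕ k ℕ.≤ toℕ i) → Dec (k ≤ᶠ j) →
          interval zero j k ≡ interval zero (inject₁ i) k + interval (suc i) j k
  split (yes k≤i) _ = begin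
    interval zero j k
      ≡⟨ interval-inside zero j k z≤n (ℕP.≤-trans k≤i (ℕP.<⇒≤ i<j)) ⟩
    1ℚ
      ≡⟨ +-identityʳ 1ℚ ⟨
    1ℚ + 0ℚ
      ≡⟨ cong₂ _+_ (interval-inside zero (inject₁ i) k z≤n (inject₁-≤ i k≤i))
                   (interval-outsideˡ (suc i) j k (ℕP.<⇒≱ (s≤s k≤i))) ⟨
    interval zero (inject₁ i) k + interval (suc i) j k
      ∎
  split (no k≰i) (yes k≤j) = begin
    interval zero j k
      ≡⟨ interval-inside zero j k z≤n k≤j ⟩
    1ℚ
      ≡⟨ +-identityˡ 1ℚ ⟨
    0ℚ + 1ℚ
      ≡⟨ cong₂ _+_ (interval-outsideʳ zero (inject₁ i) k (λ k≤i → k≰i (inject₁-≤⁻¹ i k≤i)))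
                   (interval-inside (suc i) j k (ℕP.≰⇒> k≰i) k≤j) ⟨
    interval zero (inject₁ i) k + interval (suc i) j k
      ∎
  split (no k≰i) (no k≰j) = begin
    interval zero j k
      ≡⟨ interval-outsideʳ zero j k k≰j ⟩
    0ℚ
      ≡⟨ +-identityˡ 0ℚ ⟨
    0ℚ + 0ℚ
      ≡⟨ cong₂ _+_ (interval-outsideʳ zero (inject₁ i) k (λ k≤i → k≰i (inject₁-≤⁻¹ i k≤i)))
                   (interval-outsideʳ (suc i) j k k≰j) ⟨
    interval zero (inject₁ i) k + interval (suc i) j k
      ∎

prefixSum : Point d → Point d
prefixSum {suc n} y k = ⟨ y , interval zero k ⟩

differences : Point d → Point d
differences x zero    = x zero
differences x (suc k) = x (suc k) - x (inject₁ k)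

⟨⟩-interval≡prefixSum-diff : (y : Point (suc n)) (i : Fin n) (j : Fin (suc n)) → suc i ≤ᶠ j →
  ⟨ y , interval (suc i) j ⟩ ≡ prefixSum y j - prefixSum y (inject₁ i)
⟨⟩-interval≡prefixSum-diff y i j i<j = begin
  ⟨ y , I ⟩
    ≡⟨ solve 2 (λ a b → b := (a :+ b) :- a) refl sᵢ ⟨ y , I ⟩ ⟩
  sᵢ + ⟨ y , I ⟩ - sᵢ
    ≡⟨ cong (_- sᵢ) (⟨⟩-distribʳ-+ y (interval zero (inject₁ i)) I) ⟨
  ⟨ y , interval zero (inject₁ i) +ₚ I ⟩ - sᵢ
    ≡⟨ cong (_- sᵢ) (⟨⟩-congʳ y (interval-split i j i<j)) ⟨
  prefixSum y j - sᵢ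
    ∎
  where
  open ≡-Reasoning
  I  = interval (suc i) j
  sᵢ = prefixSum y (inject₁ i)

prefixSum-suc : (y : Point (suc n)) (k : Fin n) → prefixSum y (suc k) ≡ prefixSum y (inject₁ k) + y (suc k)
prefixSum-suc y k = begin
  prefixSum y (suc k)
    ≡⟨ solve 2 (λ a b → b := a :+ (b :- a)) refl sₖ (prefixSum y (suc k)) ⟩
  sₖ + (prefixSum y (suc k) - sₖ)
    ≡⟨ cong (sₖ +_) (⟨⟩-interval≡prefixSum-diff y k (suc k) ℕP.≤-refl) ⟨
  sₖ + ⟨ y , interval (suc k) (suc k) ⟩
    ≡⟨ cong (sₖ +_) (⟨⟩-interval-diag y (suc k)) ⟩
  sₖ + y (suc k)
    ∎
  where
  open ≡-Reasoning
  sₖ = prefixSum y (inject₁ k)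

differences-prefixSum : (y : Point d) → differences (prefixSum y) ≈ₚ y
differences-prefixSum y zero    = ⟨⟩-interval-diag y zero
differences-prefixSum y (suc k) = begin
  prefixSum y (suc k) - sₖ  ≡⟨ cong (_- sₖ) (prefixSum-suc y k) ⟩
  sₖ + y (suc k) - sₖ       ≡⟨ solve 2 (λ a b → a :+ b :- a := b) refl sₖ (y (suc k)) ⟩
  y (suc k)                 ∎
  where
  open ≡-Reasoning
  sₖ = prefixSum y (inject₁ k)

differences≈⇒prefixSum≈ : {x y : Point d} → differences x ≈ₚ y → prefixSum y ≈ₚ x
differences≈⇒prefixSum≈ {suc n} {x} {y} Δx≈y = <-weakInduction (λ k → prefixSum y k ≡ x k) base step
  where
  open ≡-Reasoning
  base : prefixSum y zero ≡ x zero
  base = trans (⟨⟩-interval-diag y zero) (sym (Δx≈y zero))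
  step : ∀ k → prefixSum y (inject₁ k) ≡ x (inject₁ k) → prefixSum y (suc k) ≡ x (suc k)
  step k sₖ≡xₖ = begin
    prefixSum y (suc k)                          ≡⟨ prefixSum-suc y k ⟩
    prefixSum y (inject₁ k) + y (suc k)          ≡⟨ cong₂ _+_ sₖ≡xₖ (sym (Δx≈y (suc k))) ⟩
    x (inject₁ k) + (x (suc k) - x (inject₁ k))  ≡⟨ solve 2 (λ a b → a :+ (b :- a) := b) refl (x (inject₁ k)) (x (suc k)) ⟩
    x (suc k)                                    ∎

In[0,1] : ℚ → Set
In[0,1] q = 0ℚ ≤ q × q ≤ 1ℚ

In[-1,1] : ℚ → Set
In[-1,1] q = - 1ℚ ≤ q × q ≤ 1ℚ

-1≤-q⇒q≤1 : {q : ℚ} → - 1ℚ ≤ - q → q ≤ 1ℚ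
-1≤-q⇒q≤1 {q} -1≤-q = begin
  q        ≡⟨ solve 1 (λ a → a := :- (:- a)) refl q ⟩
  - (- q)  ≤⟨ neg-antimono-≤ -1≤-q ⟩
  1ℚ       ∎
  where open ≤-Reasoning

IntervalBounded : PSet d
IntervalBounded y = ∀ i j → i ≤ᶠ j → In[-1,1] ⟨ y , interval i j ⟩

DifferenceBounded : PSet d
DifferenceBounded x = (∀ k → In[-1,1] (x k)) × (∀ k l → x k - x l ≤ 1ℚ)

DifferenceBounded-diff : {x : Point d} → DifferenceBounded x → ∀ k l → In[-1,1] (x k - x l)
DifferenceBounded-diff {x = x} (_ , x-diff) k l = -1≤xₖ-xₗ , x-diff k l
  where
  open ≤-Reasoning
  -1≤xₖ-xₗ = begin
    - 1ℚ           ≤⟨ neg-antimono-≤ (x-diff l k) ⟩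
    - (x l - x k)  ≡⟨ solve 2 (λ a b → :- (b :- a) := a :- b) refl (x k) (x l) ⟩
    x k - x l      ∎

DifferenceBounded-cong : {x x′ : Point d} → x ≈ₚ x′ → DifferenceBounded x → DifferenceBounded x′
DifferenceBounded-cong x≈x′ (x-bound , x-diff) =
  (λ k → subst In[-1,1] (x≈x′ k) (x-bound k)) ,
  (λ k l → subst (_≤ 1ℚ) (cong₂ _-_ (x≈x′ k) (x≈x′ l)) (x-diff k l))

polar-A⇔IntervalBounded : (y : Point d) → polar (A d) y ⇔ IntervalBounded y
polar-A⇔IntervalBounded y = mk⇔ to from
  where
  to : polar (A _) y → IntervalBounded y
  to y∈ i j i≤j = y∈ I (⊆-conv (i , j , i≤j , inj₁ (λ _ → refl))) , -1≤-q⇒q≤1 -1≤-⟨y,I⟩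
    where
    I = interval i j
    -1≤-⟨y,I⟩ = subst (- 1ℚ ≤_) (⟨⟩-negʳ y I) (y∈ (-ₚ I) (⊆-conv (i , j , i≤j , inj₂ (λ _ → refl))))
  from : IntervalBounded y → polar (A _) y
  from bounded = polar-conv y generator-bound
    where
    generator-bound : ∀ g → rootGens _ g → - 1ℚ ≤ ⟨ y , g ⟩
    generator-bound g (i , j , i≤j , inj₁ g≈I) =
      subst (- 1ℚ ≤_) (sym (⟨⟩-congʳ y g≈I)) (proj₁ (bounded i j i≤j))
    generator-bound g (i , j , i≤j , inj₂ g≈-I) =
      subst (- 1ℚ ≤_) (sym (trans (⟨⟩-congʳ y g≈-I) (⟨⟩-negʳ y (interval i j))))
                      (neg-antimono-≤ (proj₂ (bounded i j i≤j)))

<⇒inject₁ : {l k : Fin (suc n)} → l <ᶠ k → ∃ λ i → inject₁ i ≡ l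
<⇒inject₁ {n} {l} {k} l<k = lower₁ l n≢l , FP.inject₁-lower₁ l n≢l
  where
  n≢l : n ≢ toℕ l
  n≢l n≡l = ℕP.<-irrefl (sym n≡l) (ℕP.<-≤-trans l<k (ℕ.s≤s⁻¹ (FP.toℕ<n k)))

prefixSum-diff-In[-1,1] : (y : Point (suc n)) → IntervalBounded y →
  ∀ {k l} → l <ᶠ k → In[-1,1] (prefixSum y k - prefixSum y l)
prefixSum-diff-In[-1,1] y bounded {k} l<k with <⇒inject₁ l<k
... | i , refl = subst In[-1,1] (⟨⟩-interval≡prefixSum-diff y i k i<k) (bounded (suc i) k i<k)
  where
  i<k : suc i ≤ᶠ k
  i<k = subst (λ m → suc m ℕ.≤ toℕ k) (FP.toℕ-inject₁ i) l<k

IntervalBounded⇔DifferenceBounded-prefixSum : (y : Point d) → IntervalBounded y ⇔ DifferenceBounded (prefixSum y)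
IntervalBounded⇔DifferenceBounded-prefixSum {zero}  y = mk⇔ (λ _ → (λ ()) , (λ ())) (λ _ ())
IntervalBounded⇔DifferenceBounded-prefixSum {suc n} y = mk⇔ to from
  where
  s = prefixSum y
  to : IntervalBounded y → DifferenceBounded s
  to bounded = (λ k → bounded zero k z≤n) , diff≤1
    where
    diff≤1 : ∀ k l → s k - s l ≤ 1ℚ
    diff≤1 k l with FP.<-cmp l k
    ... | tri< l<k _ _  = proj₂ (prefixSum-diff-In[-1,1] y bounded l<k)
    ... | tri≈ _ refl _ = ≤-trans (≤-reflexive (+-inverseʳ (s k))) 0≤1
    ... | tri> _ _ k<l  = -1≤-q⇒q≤1 (subst (- 1ℚ ≤_) (solve 2 (λ a b → b :- a := :- (a :- b)) refl (s k) (s l))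
                                                    (proj₁ (prefixSum-diff-In[-1,1] y bounded k<l)))
  from : DifferenceBounded s → IntervalBounded y
  from s-bounded zero    j _   = proj₁ s-bounded j
  from s-bounded (suc i) j i<j = subst In[-1,1] (sym (⟨⟩-interval≡prefixSum-diff y i j i<j))
                                                (DifferenceBounded-diff s-bounded j (inject₁ i))

-- The projected cube

In[0,1]-diff : {a b : ℚ} → In[0,1] a → In[0,1] b → In[-1,1] (a - b)
In[0,1]-diff (0≤a , a≤1) (0≤b , b≤1) = +-mono-≤ 0≤a (neg-antimono-≤ b≤1) , +-mono-≤ a≤1 (neg-antimono-≤ 0≤b)

proj-cube⇒DifferenceBounded : {x : Point d} → image proj (cube (suc d)) x → DifferenceBounded x
proj-cube⇒DifferenceBounded {d} {x} (z , z∈ , πz≈x) = coordinate-bound , diff≤1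
  where
  coordinate-bound : ∀ k → In[-1,1] (x k)
  coordinate-bound k = subst In[-1,1] (πz≈x k) (In[0,1]-diff (z∈ (inject₁ k)) (z∈ (fromℕ d)))
  diff≤1 : ∀ k l → x k - x l ≤ 1ℚ
  diff≤1 k l = subst (_≤ 1ℚ) πz-diff (proj₂ (In[0,1]-diff (z∈ (inject₁ k)) (z∈ (inject₁ l))))
    where
    πz-diff : z (inject₁ k) - z (inject₁ l) ≡ x k - x l
    πz-diff = trans (solve 3 (λ a b c → a :- b := (a :- c) :- (b :- c)) refl (z (inject₁ k)) (z (inject₁ l)) (z (fromℕ d)))
                    (cong₂ _-_ (πz≈x k) (πz≈x l))

min₀ : Point d → ℚ
min₀ {zero}  x = 0ℚ
min₀ {suc d} x = x zero ⊓ min₀ (λ i → x (suc i))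

min₀≤0 : (x : Point d) → min₀ x ≤ 0ℚ
min₀≤0 {zero}  x = ≤-refl
min₀≤0 {suc d} x = p≤q⇒r⊓p≤q (x zero) (min₀≤0 (λ i → x (suc i)))

min₀≤ : (x : Point d) (k : Fin d) → min₀ x ≤ x k
min₀≤ {suc d} x zero    = p⊓q≤p (x zero) _
min₀≤ {suc d} x (suc k) = p≤q⇒r⊓p≤q (x zero) (min₀≤ (λ i → x (suc i)) k)

min₀-attained : (x : Point d) → min₀ x ≡ 0ℚ ⊎ ∃ λ l → min₀ x ≡ x l
min₀-attained {zero}  x = inj₁ refl
min₀-attained {suc d} x with ⊓-sel (x zero) (min₀ (λ i → x (suc i)))
... | inj₁ m≡x₀ = inj₂ (zero , m≡x₀)
... | inj₂ m≡m′ with min₀-attained (λ i → x (suc i))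
...   | inj₁ m′≡0        = inj₁ (trans m≡m′ m′≡0)
...   | inj₂ (l , m′≡xₗ) = inj₂ (suc l , trans m≡m′ m′≡xₗ)

snoc : Point d → ℚ → Point (suc d)
snoc {zero}  x t zero    = t
snoc {suc d} x t zero    = x zero
snoc {suc d} x t (suc k) = snoc (λ i → x (suc i)) t k

snoc-inject₁ : (x : Point d) (t : ℚ) (k : Fin d) → snoc x t (inject₁ k) ≡ x k
snoc-inject₁ {suc d} x t zero    = refl
snoc-inject₁ {suc d} x t (suc k) = snoc-inject₁ (λ i → x (suc i)) t k

snoc-last : (x : Point d) (t : ℚ) → snoc x t (fromℕ d) ≡ t
snoc-last {zero}  x t = refl
snoc-last {suc d} x t = snoc-last (λ i → x (suc i)) t

snoc-∀ : (P : ℚ → Set) {x : Point d} {t : ℚ} → (∀ k → P (x k)) → P t → ∀ i → P (snoc x t i)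
snoc-∀ {zero}  P Px Pt zero    = Pt
snoc-∀ {suc d} P Px Pt zero    = Px zero
snoc-∀ {suc d} P Px Pt (suc k) = snoc-∀ P (λ k → Px (suc k)) Pt k

DifferenceBounded⇒proj-cube : {x : Point d} → DifferenceBounded x → image proj (cube (suc d)) x
DifferenceBounded⇒proj-cube {d} {x} (x-bound , x-diff) = snoc x+t t , snoc-∀ In[0,1] x+t∈ t∈ , πz≈x
  where
  t = - min₀ x
  x+t : Point d
  x+t k = x k + t
  t∈ : In[0,1] t
  t∈ = neg-antimono-≤ (min₀≤0 x) , t≤1
    where
    t≤1 : t ≤ 1ℚ
    t≤1 with min₀-attained x
    ... | inj₁ m≡0        = ≤-trans (≤-reflexive (cong -_ m≡0)) 0≤1
    ... | inj₂ (l , m≡xₗ) = subst (λ m → - m ≤ 1ℚ) (sym m≡xₗ) (neg-antimono-≤ (proj₁ (x-bound l)))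
  x+t∈ : ∀ k → In[0,1] (x+t k)
  x+t∈ k = ≤-trans (≤-reflexive (sym (+-inverseʳ (min₀ x)))) (+-monoˡ-≤ t (min₀≤ x k)) , x+t≤1
    where
    x+t≤1 : x+t k ≤ 1ℚ
    x+t≤1 with min₀-attained x
    ... | inj₁ m≡0        = subst (λ m → x k - m ≤ 1ℚ) (sym m≡0)
                                  (≤-trans (≤-reflexive (+-identityʳ (x k))) (proj₂ (x-bound k)))
    ... | inj₂ (l , m≡xₗ) = subst (λ m → x k - m ≤ 1ℚ) (sym m≡xₗ) (x-diff k l)
  πz≈x : proj (snoc x+t t) ≈ₚ x
  πz≈x k = trans (cong₂ _-_ (snoc-inject₁ x+t t k) (snoc-last x+t t))
                 (solve 2 (λ a b → (a :+ b) :- b := a) refl (x k) t)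

-- The difference matrix

-- The tail of the sum is read as an entry of a smaller product, which needs a nonempty index type.
∙ℤ≡sum : (M N : Matℤ e) (i j : Fin e) → (M ∙ℤ N) i j ≡ ℤΣ.sum (λ k → M i k ℤ.* N k j)
∙ℤ≡sum {suc zero}    M N i j = refl
∙ℤ≡sum {suc (suc e)} M N i j =
  cong (ℤ._+_ (M i zero ℤ.* N zero j)) (∙ℤ≡sum (λ _ b → M i (suc b)) (λ a _ → N (suc a) j) zero zero)

Idℤ-suc : (i j : Fin e) → Idℤ (suc i) (suc j) ≡ Idℤ i j
Idℤ-suc i j with i FP.≟ j
... | yes refl = refl
... | no _     = refl

_·ᵥ_ : Matℤ e → (Fin e → ℤ) → Fin e → ℤ
(M ·ᵥ v) i = ℤΣ.sum (λ k → M i k ℤ.* v k)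

·ᵥ-zeroʳ : (M : Matℤ e) (i : Fin e) → (M ·ᵥ (λ _ → 0ℤ)) i ≡ 0ℤ
·ᵥ-zeroʳ {e} M i = trans (ℤΣ.sum-cong-≗ (λ k → ℤP.*-zeroʳ (M i k))) (ℤΣ.sum-replicate-zero e)

bordered : (Fin e → ℤ) → Matℤ e → Matℤ (suc e)
bordered c M zero    zero    = 1ℤ
bordered c M zero    (suc k) = 0ℤ
bordered c M (suc i) zero    = c i
bordered c M (suc i) (suc k) = M i k

bordered-·ᵥ-zero : (c : Fin e → ℤ) (M : Matℤ e) (v : Fin (suc e) → ℤ) → (bordered c M ·ᵥ v) zero ≡ v zero
bordered-·ᵥ-zero {e} c M v = begin
  1ℤ ℤ.* v zero ℤ.+ ℤΣ.sum {e} (λ _ → 0ℤ)  ≡⟨ cong₂ ℤ._+_ (ℤP.*-identityˡ (v zero)) (ℤΣ.sum-replicate-zero e) ⟩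
  v zero ℤ.+ 0ℤ                            ≡⟨ ℤP.+-identityʳ (v zero) ⟩
  v zero                                   ∎
  where open ≡-Reasoning

bordered-inverse : (c c′ : Fin e → ℤ) (M N : Matℤ e) →
  (∀ i j → (M ∙ℤ N) i j ≡ Idℤ i j) → (∀ i → c i ℤ.+ (M ·ᵥ c′) i ≡ 0ℤ) →
  ∀ i j → (bordered c M ∙ℤ bordered c′ N) i j ≡ Idℤ i j
bordered-inverse {e} c c′ M N MN≡I c+Mc′≡0 i j = trans (∙ℤ≡sum (bordered c M) (bordered c′ N) i j) (entry i j)
  where
  open ≡-Reasoning
  entry : ∀ i j → ℤΣ.sum (λ k → bordered c M i k ℤ.* bordered c′ N k j) ≡ Idℤ i j
  entry zero    zero    = cong (ℤ._+_ 1ℤ) (ℤΣ.sum-replicate-zero e)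
  entry zero    (suc j) = trans (ℤP.+-identityˡ _) (ℤΣ.sum-replicate-zero e)
  entry (suc i) zero    = trans (cong (ℤ._+ (M ·ᵥ c′) i) (ℤP.*-identityʳ (c i))) (c+Mc′≡0 i)
  entry (suc i) (suc j) = begin
    c i ℤ.* 0ℤ ℤ.+ ℤΣ.sum (λ k → M i k ℤ.* N k j)  ≡⟨ cong (ℤ._+ _) (ℤP.*-zeroʳ (c i)) ⟩
    0ℤ ℤ.+ ℤΣ.sum (λ k → M i k ℤ.* N k j)          ≡⟨ ℤP.+-identityˡ _ ⟩
    ℤΣ.sum (λ k → M i k ℤ.* N k j)                 ≡⟨ ∙ℤ≡sum M N i j ⟨
    (M ∙ℤ N) i j                                   ≡⟨ MN≡I i j ⟩
    Idℤ i j                                        ≡⟨ Idℤ-suc i j ⟨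
    Idℤ (suc i) (suc j)                            ∎

e₀ : Fin e → ℤ
e₀ zero    = 1ℤ
e₀ (suc _) = 0ℤ

differenceMatrix : Matℤ e
differenceMatrix {zero}  = λ ()
differenceMatrix {suc e} = bordered (λ i → ℤ.- e₀ i) differenceMatrix

summationMatrix : Matℤ e
summationMatrix {zero}  = λ ()
summationMatrix {suc e} = bordered (λ _ → 1ℤ) summationMatrix

differenceMatrix-rowSum : (i : Fin e) → (differenceMatrix ·ᵥ (λ _ → 1ℤ)) i ≡ e₀ i
differenceMatrix-rowSum {suc e} zero    = bordered-·ᵥ-zero (λ i → ℤ.- e₀ i) (differenceMatrix {e}) (λ _ → 1ℤ)
differenceMatrix-rowSum {suc e} (suc i) = begin
  ℤ.- e₀ i ℤ.* 1ℤ ℤ.+ (differenceMatrix ·ᵥ (λ _ → 1ℤ)) i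
    ≡⟨ cong₂ ℤ._+_ (ℤP.*-identityʳ (ℤ.- e₀ i)) (differenceMatrix-rowSum i) ⟩
  ℤ.- e₀ i ℤ.+ e₀ i
    ≡⟨ ℤP.+-inverseˡ (e₀ i) ⟩
  0ℤ
    ∎
  where open ≡-Reasoning

summationMatrix-·ᵥ-neg-e₀ : (i : Fin e) → (summationMatrix ·ᵥ (λ k → ℤ.- e₀ k)) i ≡ -1ℤ
summationMatrix-·ᵥ-neg-e₀ {suc e} zero    = bordered-·ᵥ-zero (λ _ → 1ℤ) (summationMatrix {e}) (λ k → ℤ.- e₀ k)
summationMatrix-·ᵥ-neg-e₀ {suc e} (suc i) = cong (ℤ._+_ -1ℤ) (·ᵥ-zeroʳ (summationMatrix {e}) i)

difference∙summation : (i j : Fin e) → (differenceMatrix ∙ℤ summationMatrix) i j ≡ Idℤ i j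
difference∙summation {suc e} =
  bordered-inverse (λ i → ℤ.- e₀ i) (λ _ → 1ℤ) (differenceMatrix {e}) summationMatrix difference∙summation
    (λ i → trans (cong (ℤ._+_ (ℤ.- e₀ i)) (differenceMatrix-rowSum i)) (ℤP.+-inverseˡ (e₀ i)))

summation∙difference : (i j : Fin e) → (summationMatrix ∙ℤ differenceMatrix) i j ≡ Idℤ i j
summation∙difference {suc e} =
  bordered-inverse (λ _ → 1ℤ) (λ i → ℤ.- e₀ i) (summationMatrix {e}) differenceMatrix summation∙difference
    (λ i → cong (ℤ._+_ 1ℤ) (summationMatrix-·ᵥ-neg-e₀ i))

differenceMatrix-invertible : GLℤ (differenceMatrix {e})
differenceMatrix-invertible = summationMatrix , difference∙summation , summation∙difference

differenceMatrix-row : (x : Point d) (i : Fin d) → Σᶠ (λ k → ℤ→ℚ (differenceMatrix i k) * x k) ≡ differences x i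
differenceMatrix-row {suc d} x zero = begin
  ℤ→ℚ 1ℤ * x zero + Σᶠ (λ k → ℤ→ℚ 0ℤ * x (suc k))
    ≡⟨ cong₂ _+_ (*-identityˡ (x zero)) (Σᶠ-zero (λ k → ℤ→ℚ 0ℤ * x (suc k)) (λ k → *-zeroˡ (x (suc k)))) ⟩
  x zero + 0ℚ
    ≡⟨ +-identityʳ (x zero) ⟩
  x zero
    ∎
  where open ≡-Reasoning
differenceMatrix-row {suc (suc d)} x (suc zero) = begin
  ℤ→ℚ -1ℤ * x zero + Σᶠ (λ k → ℤ→ℚ (differenceMatrix zero k) * x (suc k))
    ≡⟨ cong (ℤ→ℚ -1ℤ * x zero +_) (differenceMatrix-row (λ k → x (suc k)) zero) ⟩
  ℤ→ℚ -1ℤ * x zero + x (suc zero)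
    ≡⟨ solve 2 (λ a b → :- con 1ℚ :* a :+ b := b :- a) refl (x zero) (x (suc zero)) ⟩
  x (suc zero) - x zero
    ∎
  where open ≡-Reasoning
differenceMatrix-row {suc (suc d)} x (suc (suc i)) =
  trans (cong₂ _+_ (*-zeroˡ (x zero)) (differenceMatrix-row (λ k → x (suc k)) (suc i))) (+-identityˡ _)

affine-differenceMatrix : (x : Point d) → affine differenceMatrix (λ _ → 0ℤ) x ≈ₚ differences x
affine-differenceMatrix x i = trans (+-identityʳ _) (differenceMatrix-row x i)

proposition1 : (m : ℕ) → UnimodEquiv (image proj (cube (suc m))) (polar (A m))
proposition1 m = differenceMatrix , (λ _ → 0ℤ) , differenceMatrix-invertible , λ y → mk⇔ (to y) (from y)
  where
  Δ = affine differenceMatrix (λ _ → 0ℤ)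
  polar⇔ : (y : Point m) → polar (A m) y ⇔ DifferenceBounded (prefixSum y)
  polar⇔ y = ⇔.trans (polar-A⇔IntervalBounded y) (IntervalBounded⇔DifferenceBounded-prefixSum y)
  to : ∀ y → polar (A m) y → image Δ (image proj (cube (suc m))) y
  to y y∈ = prefixSum y , DifferenceBounded⇒proj-cube (Equivalence.to (polar⇔ y) y∈) ,
            λ k → trans (affine-differenceMatrix (prefixSum y) k) (differences-prefixSum y k)
  from : ∀ y → image Δ (image proj (cube (suc m))) y → polar (A m) y
  from y (x , x∈ , Δx≈y) = Equivalence.from (polar⇔ y) (DifferenceBounded-cong x≈s (proj-cube⇒DifferenceBounded x∈))
    where
    x≈s : x ≈ₚ prefixSum y
    x≈s k = sym (differences≈⇒prefixSum≈ (λ k → trans (sym (affine-differenceMatrix x k)) (Δx≈y k)) k)
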